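{- Let $\Phi$ be a Q3SAT formula and $\Gamma_\Phi$ the CSTN constructed from it. If $\Phi$ is true, then $\Gamma_\Phi$ is dynamically controllable.
   Context: CSTN notions: a label over a finite set $\mathcal P$ of propositional variables is a conjunction of literals on distinct variables; the empty label $\lambda$ is always true. A scenario is $s:\mathcal P\to\{0,1\}$; $s\vDash\ell$ means $\ell$ true under $s$. A CSTN is $\Gamma=(\mathcal T,\mathcal P,\mathcal C,\mathcal L,\mathcal{OT},\mathcal O)$ with $\mathcal T$ a finite set of tasks, $\mathcal C$ a finite set of labeled constraints $(Y-X\le\delta,\ell)$, $\mathcal L$ a label on each task, $\mathcal{OT}\subseteq\mathcal T$, $\mathcal O:\mathcal P\to\mathcal{OT}$ a bijection. For a scenario $s$, $\mathcal T_s=\{X:s\vDash\mathcal L(X)\}$ and $\mathcal C_s$ is the set of constraints $Y-X\le\delta$ whose label holds in $s$. An execution strategy $\sigma$ maps each scenario $s$ to $\sigma(s):\mathcal T_s\to\mathbb R$ (write $[\sigma(s)]_X$); it is viable if each $\sigma(s)$ satisfies all constraints of $\mathcal C_s$. $\mathrm{Hist}(t,s,\sigma)$ is the restriction of $s$ to $\{p:[\sigma(s)]_{\mathcal O(p)}<t\}$. $\sigma$ is dynamic if for all $s,s'$ and $X\in\mathcal T_s$, with $t=[\sigma(s)]_X$, $\mathrm{Hist}(t,s,\sigma)=\mathrm{Hist}(t,s',\sigma)$ implies $X\in\mathcal T_{s'}$ and $[\sigma(s')]_X=t$. $\Gamma$ is dynamically controllable if it has a dynamic viable execution strategy. Construction: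 $\Phi=\exists x_1\forall y_1\cdots\exists x_n\forall y_n\,\varphi$ with $\varphi=\bigwedge_{j=1}^m(l_{j,1}\vee l_{j,2}\vee l_{j,3})$, each literal $l_{j,k}$ a positive or negated occurrence of one of $x_1,y_1,\dots,x_n,y_n$; $\Phi$ is true iff the quantified boolean formula holds. $\Gamma_\Phi$ has tasks $A_i,B_i,C_i^0,C_i^1,D_i,X_i,Y_i$ ($i=1,\dots,n$) and $A_{n+1},B_{n+1}$; propositional variables $x_i,y_i,c_i^0,c_i^1$ ($i=1,\dots,n$); every task has empty label; observation tasks $\mathcal O(x_i)=X_i$, $\mathcal O(y_i)=Y_i$, $\mathcal O(c_i^0)=C_i^0$, $\mathcal O(c_i^1)=C_i^1$; constraints: $(B_1-A_1\le0,\lambda)$; for $i=1,\dots,n$: $(D_i\le B_i+1,\ c_i^0\wedge c_i^1)$, $(D_i\ge A_i+(n+2),\ \neg c_i^0\wedge\neg c_i^1)$, $(X_i\ge A_i+(n+2),\lambda)$, $(Y_i\ge X_i+1,\lambda)$, $(A_{i+1}\ge Y_i+1,\lambda)$, $(B_{i+1}\le C_i^0+(n+4),\ \neg x_i)$, $(B_{i+1}\le C_i^1+(n+4),\ x_i)$; for $j=1,\dots,m$: $(B_{n+1}-A_{n+1}\ge n+1,\ \neg l_{j,1}\wedge\neg l_{j,2}\wedge\neg l_{j,3})$. -}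

module Defs where

open import Data.Nat using (ℕ; zero; suc; _+_)
open import Data.Integer using (ℤ; +_; -_)
open import Data.Rational using (ℚ; _/_; _≤_; _<_; _-_)
open import Data.Bool using (Bool; true; false; not; _∧_; if_then_else_)
open import Data.Fin using (Fin; zero; suc; inject₁; fromℕ)
open import Data.Fin.Properties using (inject₁-injective)
open import Data.Vec using (Vec; []; _∷_; lookup)
open import Data.List using (List; []; _∷_; _++_; concatMap; map; foldr)
open import Data.List.Membership.Propositional using (_∈_)
open import Data.Product using (Σ; _×_; _,_; proj₁; proj₂)
open import Data.Empty using (⊥)
open import Relation.Binary.PropositionalEquality using (_≡_; refl; cong)
open import Function using (_↔_)
open import Function.Definitions using (Injective)

-- A label: a conjunction of literals, given as a list of
-- (variable , polarity); the empty list is the empty label λ.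
Label : Set → Set
Label V = List (V × Bool)

Scenario : Set → Set
Scenario V = V → Bool

litVal : {V : Set} → Scenario V → V × Bool → Bool
litVal s (p , b) = if b then s p else not (s p)

evalLabel : {V : Set} → Scenario V → Label V → Bool
evalLabel s ℓ = foldr (λ l r → litVal s l ∧ r) true ℓ

_⊨_ : {V : Set} → Scenario V → Label V → Set
s ⊨ ℓ = evalLabel s ℓ ≡ true

record Constraint (T V : Set) : Set where
  constructor cstr
  field
    Y     : T
    X     : T
    δ     : ℚ
    label : Label V

record CSTN : Set₁ where
  field
    Task    : Set
    Var     : Set
    C       : List (Constraint Task Var)
    L       : Task → Label Var
    -- the observation map O : P → OT ⊆ T; OT is its image,
    -- so O is a bijection onto OT iff it is injective
    O       : Var → Task
    O-inj   : Injective _≡_ _≡_ O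

module _ (Γ : CSTN) where
  open CSTN Γ

  InScenario : Scenario Var → Task → Set
  InScenario s X = s ⊨ L X

  -- An execution strategy: σ(s) assigns a time to each task; only the
  -- values on 𝒯_s are meaningful.
  Strategy : Set
  Strategy = Scenario Var → Task → ℚ

  Viable : Strategy → Set
  Viable σ = ∀ (s : Scenario Var) (c : Constraint Task Var) → c ∈ C →
    s ⊨ Constraint.label c →
    (σ s (Constraint.Y c) - σ s (Constraint.X c)) ≤ Constraint.δ c

  -- p belongs to the domain of Hist(t, s, σ)
  InHist : Strategy → ℚ → Scenario Var → Var → Set
  InHist σ t s p = InScenario s (O p) × (σ s (O p) < t)

  -- Hist(t, s, σ) = Hist(t, s', σ) as partial functions
  HistEq : Strategy → ℚ → Scenario Var → Scenario Var → Set
  HistEq σ t s s' = ∀ (p : Var) →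
    (InHist σ t s p ↔ InHist σ t s' p) × (InHist σ t s p → s p ≡ s' p)

  Dynamic : Strategy → Set
  Dynamic σ = ∀ (s s' : Scenario Var) (X : Task) → InScenario s X →
    HistEq σ (σ s X) s s' →
    InScenario s' X × (σ s' X ≡ σ s X)

  DynamicallyControllable : Set
  DynamicallyControllable = Σ Strategy λ σ → Viable σ × Dynamic σ

-- the boolean variables x_1,y_1,...,x_n,y_n (index i : Fin n is i+1)
data QVar (n : ℕ) : Set where
  qx qy : Fin n → QVar n

QLit : ℕ → Set
QLit n = QVar n × Bool

Formula : ℕ → ℕ → Set
Formula n m = Fin m → Fin 3 → QLit n

qvarVal : {n : ℕ} → Vec (Bool × Bool) n → QVar n → Bool
qvarVal v (qx i) = proj₁ (lookup v i)
qvarVal v (qy i) = proj₂ (lookup v i)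

qlitVal : {n : ℕ} → Vec (Bool × Bool) n → QLit n → Bool
qlitVal v (p , b) = if b then qvarVal v p else not (qvarVal v p)

Satisfies : {n m : ℕ} → Formula n m → Vec (Bool × Bool) n → Set
Satisfies φ v = ∀ j → Σ (Fin 3) λ k → qlitVal v (φ j k) ≡ true

-- ∃ x ∀ y ... over r remaining pairs, outermost pair first
Game : (r : ℕ) → (Vec (Bool × Bool) r → Set) → Set
Game zero    P = P []
Game (suc r) P = Σ Bool λ a → (b : Bool) → Game r (λ v → P ((a , b) ∷ v))

Q3SATTrue : {n m : ℕ} → Formula n m → Set
Q3SATTrue {n} φ = Game n (Satisfies φ)

-- A i, B i for i : Fin (suc n) stand for A_{i+1}, B_{i+1};
-- the other tasks for i : Fin n stand for C⁰_{i+1}, … .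
data TaskΦ (n : ℕ) : Set where
  tA tB              : Fin (suc n) → TaskΦ n
  tC0 tC1 tD tX tY   : Fin n → TaskΦ n

data VarΦ (n : ℕ) : Set where
  vx vy vc0 vc1 : Fin n → VarΦ n

OΦ : {n : ℕ} → VarΦ n → TaskΦ n
OΦ (vx i)  = tX i
OΦ (vy i)  = tY i
OΦ (vc0 i) = tC0 i
OΦ (vc1 i) = tC1 i

OΦ-inj : {n : ℕ} → Injective _≡_ _≡_ (OΦ {n})
OΦ-inj {x = vx i}  {vx .i}  refl = refl
OΦ-inj {x = vy i}  {vy .i}  refl = refl
OΦ-inj {x = vc0 i} {vc0 .i} refl = refl
OΦ-inj {x = vc1 i} {vc1 .i} refl = refl

ℤtoℚ : ℤ → ℚ
ℤtoℚ z = z / 1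

qvarToVar : {n : ℕ} → QVar n → VarΦ n
qvarToVar (qx i) = vx i
qvarToVar (qy i) = vy i

clauseLabel : {n : ℕ} → (Fin 3 → QLit n) → Label (VarΦ n)
clauseLabel cl = neg (cl zero) ∷ neg (cl (suc zero)) ∷ neg (cl (suc (suc zero))) ∷ []
  where
  neg : _ → _
  neg (p , b) = qvarToVar p , not b

-- constraints for a fixed i (paper index i+1)
perStage : (n : ℕ) → Fin n → List (Constraint (TaskΦ n) (VarΦ n))
perStage n i =
    -- D_i ≤ B_i + 1            if c⁰_i ∧ c¹_i
    cstr (tD i) (tB (inject₁ i)) (ℤtoℚ (+ 1)) ((vc0 i , true) ∷ (vc1 i , true) ∷ [])
    -- D_i ≥ A_i + (n+2)        if ¬c⁰_i ∧ ¬c¹_i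
  ∷ cstr (tA (inject₁ i)) (tD i) (ℤtoℚ (- (+ (n + 2)))) ((vc0 i , false) ∷ (vc1 i , false) ∷ [])
    -- X_i ≥ A_i + (n+2)
  ∷ cstr (tA (inject₁ i)) (tX i) (ℤtoℚ (- (+ (n + 2)))) []
    -- Y_i ≥ X_i + 1
  ∷ cstr (tX i) (tY i) (ℤtoℚ (- (+ 1))) []
    -- A_{i+1} ≥ Y_i + 1
  ∷ cstr (tY i) (tA (suc i)) (ℤtoℚ (- (+ 1))) []
    -- B_{i+1} ≤ C⁰_i + (n+4)   if ¬x_i
  ∷ cstr (tB (suc i)) (tC0 i) (ℤtoℚ (+ (n + 4))) ((vx i , false) ∷ [])
    -- B_{i+1} ≤ C¹_i + (n+4)   if x_i
  ∷ cstr (tB (suc i)) (tC1 i) (ℤtoℚ (+ (n + 4))) ((vx i , true) ∷ [])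
  ∷ []

allFinL : (k : ℕ) → List (Fin k)
allFinL zero    = []
allFinL (suc k) = zero ∷ map suc (allFinL k)

ΓΦ : (n m : ℕ) → Formula n m → CSTN
ΓΦ n m φ = record
  { Task  = TaskΦ n
  ; Var   = VarΦ n
  ; C     =
        cstr (tB zero) (tA zero) (ℤtoℚ (+ 0)) []
      ∷ (concatMap (perStage n) (allFinL n)
      -- B_{n+1} - A_{n+1} ≥ n+1 , i.e. A_{n+1} - B_{n+1} ≤ -(n+1), if ¬l_{j,1}∧¬l_{j,2}∧¬l_{j,3}
      ++ map (λ j → cstr (tA (fromℕ n)) (tB (fromℕ n)) (ℤtoℚ (- (+ (n + 1)))) (clauseLabel (φ j)))
             (allFinL m))
  ; L     = λ _ → []
  ; O     = OΦ
  ; O-inj = OΦ-inj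
  }

-- Fix a winning strategy of the ∃-player of Φ. Stage i of the execution occupies
-- [iK, (i+1)K) with K = n + 4: A_i at its start, X_i and Y_i at offsets n+2 and n+3.
-- Of C_i⁰ and C_i¹, the one for the move b recommended by the winning strategy
-- (given the y's observed so far) runs at A_i, the other at A_{i+1}. As long as
-- every observed x_j followed its recommendation, B_i runs at A_i and D_i at A_i + 1
-- or A_i + n + 2 according to the value of c_i^b, already observed at A_i; after a
-- departure B_i is delayed by n + 1 and D_i runs at A_i + n + 2. Without a departure
-- the observed x's and y's form a play of the winning strategy, so φ holds and no
-- clause constraint is active; after one, the delay of B_{n+1} meets them all. Each
-- time depends only on strictly earlier observations, so the strategy is dynamic.

module Submission where

open import Defs
open import Data.Nat as ℕ using (ℕ; suc; _+_; _*_; _∸_; z≤n; s≤s; z<s; s<s)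
import Data.Nat.Properties as ℕP
import Data.Nat.Tactic.RingSolver as ℕSolver
open import Data.Integer as ℤ using (+_; -_; _⊖_)
import Data.Integer.Properties as ℤP
import Data.Integer.Tactic.RingSolver as ℤSolver
open import Data.Rational as ℚ using (toℚᵘ)
import Data.Rational.Properties as ℚP
open import Data.Rational.Unnormalised as ℚᵘ using (mkℚᵘ; *≤*; *<*) renaming (_≃_ to _≃ᵘ_)
import Data.Rational.Unnormalised.Properties as ℚᵘP
open import Data.Bool using (Bool; true; false; not; _∨_; _xor_; if_then_else_)
import Data.Bool.Properties as BoolP
open import Data.Fin using (Fin; zero; suc; toℕ; inject₁; fromℕ)
open import Data.Fin.Properties using (toℕ-inject₁)
open import Data.Vec using (Vec; _∷_; tabulate)
open import Data.Vec.Properties using (lookup∘tabulate)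
open import Data.List using ([]; _∷_; concatMap)
open import Data.List.Relation.Unary.All using (All; []; _∷_)
open import Data.List.Relation.Unary.Any using (here; there; satisfied)
open import Data.List.Membership.Propositional using (_∈_)
open import Data.List.Membership.Propositional.Properties using (∈-++⁻; ∈-map⁻; ∈-concatMap⁻)
open import Data.Product using (_×_; _,_; proj₁; proj₂)
open import Data.Sum using (inj₁; inj₂)
open import Function using (_∘_)
open import Relation.Binary.PropositionalEquality

⟦_⟧ : ℕ → ℚ.ℚ
⟦ t ⟧ = ℤtoℚ (+ t)

-- ℤtoℚ z is definitionally fromℚᵘ (mkℚᵘ z 0).
toℚᵘ-ℤtoℚ : ∀ z → toℚᵘ (ℤtoℚ z) ≃ᵘ mkℚᵘ z 0
toℚᵘ-ℤtoℚ z = ℚP.toℚᵘ-fromℚᵘ (mkℚᵘ z 0)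

ℤtoℚ-mono-< : ∀ {a b} → a ℤ.< b → ℤtoℚ a ℚ.< ℤtoℚ b
ℤtoℚ-mono-< {a} {b} a<b = ℚP.toℚᵘ-cancel-<
  (ℚᵘP.<-respˡ-≃ (ℚᵘP.≃-sym (toℚᵘ-ℤtoℚ a)) (ℚᵘP.<-respʳ-≃ (ℚᵘP.≃-sym (toℚᵘ-ℤtoℚ b))
    (*<* (subst₂ ℤ._<_ (sym (ℤP.*-identityʳ a)) (sym (ℤP.*-identityʳ b)) a<b))))

ℤtoℚ-sub-≤ : ∀ {a b d} → a ℤ.- b ℤ.≤ d → ℤtoℚ a ℚ.- ℤtoℚ b ℚ.≤ ℤtoℚ d
ℤtoℚ-sub-≤ {a} {b} {d} a-b≤d = ℚP.toℚᵘ-cancel-≤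
  (ℚᵘP.≤-respˡ-≃ (ℚᵘP.≃-sym toℚᵘ-sub) (ℚᵘP.≤-respʳ-≃ (ℚᵘP.≃-sym (toℚᵘ-ℤtoℚ d))
    (*≤* (subst₂ ℤ._≤_ (lhs a b) (rhs d) a-b≤d))))
  where
  toℚᵘ-sub : toℚᵘ (ℤtoℚ a ℚ.- ℤtoℚ b) ≃ᵘ mkℚᵘ a 0 ℚᵘ.- mkℚᵘ b 0
  toℚᵘ-sub = ℚᵘP.≃-trans (ℚP.toℚᵘ-homo-+ (ℤtoℚ a) (ℚ.- ℤtoℚ b))
    (ℚᵘP.+-cong (toℚᵘ-ℤtoℚ a) (ℚᵘP.≃-trans (ℚP.toℚᵘ-homo‿- (ℤtoℚ b)) (ℚᵘP.-‿cong (toℚᵘ-ℤtoℚ b))))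
  lhs : ∀ a b → a ℤ.- b ≡ (a ℤ.* + 1 ℤ.+ (- b) ℤ.* + 1) ℤ.* + 1
  lhs = ℤSolver.solve-∀
  rhs : ∀ d → d ≡ d ℤ.* (+ 1 ℤ.* + 1)
  rhs = ℤSolver.solve-∀

⟦⟧-mono-< : ∀ {a b} → a ℕ.< b → ⟦ a ⟧ ℚ.< ⟦ b ⟧
⟦⟧-mono-< a<b = ℤtoℚ-mono-< (ℤ.+<+ a<b)

sub-≤-pos : ∀ y x k → y ℕ.≤ x + k → ⟦ y ⟧ ℚ.- ⟦ x ⟧ ℚ.≤ ℤtoℚ (+ k)
sub-≤-pos y x k y≤x+k = ℤtoℚ-sub-≤ {+ y} {+ x} (begin
  + y ℤ.- + x     ≡⟨ ℤP.m-n≡m⊖n y x ⟩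
  y ⊖ x           ≤⟨ ℤP.⊖-monoˡ-≤ x y≤x+k ⟩
  (x + k) ⊖ x     ≡⟨ ℤP.⊖-≥ (ℕP.m≤m+n x k) ⟩
  + (x + k ∸ x)   ≡⟨ cong +_ (ℕP.m+n∸m≡n x k) ⟩
  + k             ∎)
  where open ℤP.≤-Reasoning

sub-≤-neg : ∀ y x k → y + k ℕ.≤ x → ⟦ y ⟧ ℚ.- ⟦ x ⟧ ℚ.≤ ℤtoℚ (- + k)
sub-≤-neg y x k y+k≤x = ℤtoℚ-sub-≤ {+ y} {+ x} (begin
  + y ℤ.- + x       ≡⟨ ℤP.m-n≡m⊖n y x ⟩
  y ⊖ x             ≤⟨ ℤP.⊖-monoʳ-≥-≤ y y+k≤x ⟩
  y ⊖ (y + k)       ≡⟨ ℤP.⊖-≤ (ℕP.m≤m+n y k) ⟩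
  - + (y + k ∸ y)   ≡⟨ cong (λ t → - + t) (ℕP.m+n∸m≡n y k) ⟩
  - + k             ∎)
  where open ℤP.≤-Reasoning

AgreeBelow : ∀ {r} → ℕ → (f g : Fin r → Bool) → Set
AgreeBelow k f g = ∀ j → toℕ j ℕ.< k → f j ≡ g j

AgreeBelow-tail : ∀ {r k} {f g : Fin (suc r) → Bool} →
                  AgreeBelow (suc k) f g → AgreeBelow k (f ∘ suc) (g ∘ suc)
AgreeBelow-tail h j j<k = h (suc j) (s<s j<k)

move : ∀ {r P} → Game r P → (Fin r → Bool) → Fin r → Bool
move {suc r} (a , _) ys zero    = a
move {suc r} (_ , f) ys (suc i) = move (f (ys zero)) (ys ∘ suc) i

deviatesBefore : ∀ {r P} → Game r P → (xs ys : Fin r → Bool) → Fin (suc r) → Bool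
deviatesBefore         _       xs ys zero    = false
deviatesBefore {suc r} (a , f) xs ys (suc i) =
  (xs zero xor a) ∨ deviatesBefore (f (ys zero)) (xs ∘ suc) (ys ∘ suc) i

deviatesBefore-suc : ∀ {r P} (g : Game r P) xs ys (i : Fin r) →
  deviatesBefore g xs ys (suc i) ≡ deviatesBefore g xs ys (inject₁ i) ∨ (xs i xor move g ys i)
deviatesBefore-suc {suc r} (a , f) xs ys zero    = BoolP.∨-identityʳ _
deviatesBefore-suc {suc r} (a , f) xs ys (suc i) =
  trans (cong ((xs zero xor a) ∨_) (deviatesBefore-suc (f (ys zero)) _ _ i))
        (sym (BoolP.∨-assoc (xs zero xor a) _ _))

move-cong : ∀ {r P} (g : Game r P) {ys ys'} (i : Fin r) →
            AgreeBelow (toℕ i) ys ys' → move g ys i ≡ move g ys' i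
move-cong {suc r} (a , f) zero    h = refl
move-cong {suc r} (a , f) (suc i) h rewrite h zero z<s = move-cong (f _) i (AgreeBelow-tail h)

deviatesBefore-cong : ∀ {r P} (g : Game r P) {xs ys xs' ys'} (i : Fin (suc r)) →
  AgreeBelow (toℕ i) xs xs' → AgreeBelow (toℕ i) ys ys' →
  deviatesBefore g xs ys i ≡ deviatesBefore g xs' ys' i
deviatesBefore-cong         g       zero    hx hy = refl
deviatesBefore-cong {suc r} (a , f) (suc i) hx hy rewrite hx zero z<s | hy zero z<s =
  cong (_ ∨_) (deviatesBefore-cong (f _) i (AgreeBelow-tail hx) (AgreeBelow-tail hy))

xor-≡false : ∀ {x y} → x xor y ≡ false → x ≡ y
xor-≡false {false} {false} _ = refl
xor-≡false {true}  {true}  _ = refl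

conforming-play-wins : ∀ {r P} (g : Game r P) xs ys →
  deviatesBefore g xs ys (fromℕ r) ≡ false → P (tabulate (λ i → xs i , ys i))
conforming-play-wins {ℕ.zero}    g       xs ys _ = g
conforming-play-wins {suc r} {P} (a , f) xs ys e =
  subst (λ x → P ((x , ys zero) ∷ tabulate (λ i → xs (suc i) , ys (suc i))))
        (sym (xor-≡false (BoolP.∨-conicalˡ _ _ e)))
        (conforming-play-wins (f (ys zero)) (xs ∘ suc) (ys ∘ suc) (BoolP.∨-conicalʳ _ _ e))

literal-holds : ∀ {V} (s : Scenario V) p b → litVal s (p , b) ≡ true → s p ≡ b
literal-holds s p true  e = e
literal-holds s p false e = BoolP.not-injective e

⊨⇒All : ∀ {V} (s : Scenario V) (ℓ : Label V) → s ⊨ ℓ → All (λ l → s (proj₁ l) ≡ proj₂ l) ℓ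
⊨⇒All s []            _ = []
⊨⇒All s ((p , b) ∷ ℓ) e = literal-holds s p b (BoolP.∧-conicalˡ (litVal s (p , b)) _ e)
                        ∷ ⊨⇒All s ℓ (BoolP.∧-conicalʳ (litVal s (p , b)) _ e)

module Strategy (n m : ℕ) (φ : Formula n m) (g : Q3SATTrue φ) where

  Γ : CSTN
  Γ = ΓΦ n m φ

  K : ℕ
  K = n + 4

  start : Fin (suc n) → ℕ
  start k = toℕ k * K

  xs ys : Scenario (VarΦ n) → Fin n → Bool
  xs s i = s (vx i)
  ys s i = s (vy i)

  play : Scenario (VarΦ n) → Vec (Bool × Bool) n
  play s = tabulate (λ i → xs s i , ys s i)

  deviated : Scenario (VarΦ n) → Fin (suc n) → Bool
  deviated s = deviatesBefore g (xs s) (ys s)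

  recommended : Scenario (VarΦ n) → Fin n → Bool
  recommended s = move g (ys s)

  postponed : Scenario (VarΦ n) → Fin n → Bool → Bool
  postponed s i b = deviated s (inject₁ i) ∨ (b xor recommended s i)

  cvar : Bool → Fin n → VarΦ n
  cvar false = vc0
  cvar true  = vc1

  bTime : Bool → ℕ → ℕ
  bTime false a = a
  bTime true  a = a + (n + 1)

  cTime : Bool → ℕ → ℕ
  cTime p a = if p then a + K else a

  dTime : Bool → Bool → ℕ → ℕ
  dTime false true a = a + 1
  dTime _     _    a = a + (n + 2)

  τ : Scenario (VarΦ n) → TaskΦ n → ℕ
  τ s (tA k)  = start k
  τ s (tB k)  = bTime (deviated s k) (start k)
  τ s (tC0 i) = cTime (postponed s i false) (start (inject₁ i))
  τ s (tC1 i) = cTime (postponed s i true) (start (inject₁ i))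
  τ s (tD i)  = dTime (deviated s (inject₁ i)) (s (cvar (recommended s i) i)) (start (inject₁ i))
  τ s (tX i)  = start (inject₁ i) + (n + 2)
  τ s (tY i)  = start (inject₁ i) + (n + 3)

  σ : Strategy Γ
  σ s X = ⟦ τ s X ⟧

  τ-cvar : ∀ s b i → τ s (OΦ (cvar b i)) ≡ cTime (postponed s i b) (start (inject₁ i))
  τ-cvar s false i = refl
  τ-cvar s true  i = refl

  start-suc : ∀ i → start (suc i) ≡ start (inject₁ i) + K
  start-suc i = trans (ℕP.+-comm K (toℕ i * K)) (cong (λ t → t * K + K) (sym (toℕ-inject₁ i)))

  stage-precedes : ∀ {j q} → j ℕ.< q → j * K + (n + 3) ℕ.< q * K
  stage-precedes {j} {suc q} (s≤s j≤q) =
    subst (ℕ._≤ suc q * K) (sym (end-of-stage n (j * K))) (ℕP.+-monoʳ-≤ K (ℕP.*-monoˡ-≤ K j≤q))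
    where
    end-of-stage : ∀ n a → suc (a + (n + 3)) ≡ (n + 4) + a
    end-of-stage = ℕSolver.solve-∀

  start-≤-bTime : ∀ d a → a ℕ.≤ bTime d a
  start-≤-bTime false a = ℕP.≤-refl
  start-≤-bTime true  a = ℕP.m≤m+n a (n + 1)

  start-≤-cTime : ∀ p a → a ℕ.≤ cTime p a
  start-≤-cTime false a = ℕP.≤-refl
  start-≤-cTime true  a = ℕP.m≤m+n a K

  start-<-dTime : ∀ d c a → a ℕ.< dTime d c a
  start-<-dTime false true  a = ℕP.m<m+n a z<s
  start-<-dTime false false a = ℕP.m<m+n a n+2>0
    where n+2>0 : n + 2 ℕ.> 0
          n+2>0 = ℕP.<-≤-trans z<s (ℕP.m≤n+m 2 n)
  start-<-dTime true  c     a = ℕP.m<m+n a n+2>0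
    where n+2>0 : n + 2 ℕ.> 0
          n+2>0 = ℕP.<-≤-trans z<s (ℕP.m≤n+m 2 n)

  bTime-≤-cTime : ∀ p a → bTime p (a + K) ℕ.≤ cTime p a + K
  bTime-≤-cTime false a = ℕP.≤-refl
  bTime-≤-cTime true  a = ℕP.+-monoʳ-≤ (a + K) (ℕP.+-monoʳ-≤ n (s≤s z≤n))

  dTime-≤-bTime : ∀ d {c} a → c ≡ true → dTime d c a ℕ.≤ bTime d a + 1
  dTime-≤-bTime false a refl = ℕP.≤-refl
  dTime-≤-bTime true  a _    = ℕP.≤-reflexive (shift n a)
    where
    shift : ∀ n a → a + (n + 2) ≡ a + (n + 1) + 1
    shift = ℕSolver.solve-∀

  dTime-≥ : ∀ d {c} a → c ≡ false → a + (n + 2) ℕ.≤ dTime d c a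
  dTime-≥ false a refl = ℕP.≤-refl
  dTime-≥ true  a _    = ℕP.≤-refl

  dTime-cong : ∀ {d d' c c'} a → d' ≡ d → (d ≡ false → c' ≡ c) → dTime d' c' a ≡ dTime d c a
  dTime-cong {true}  a refl _ = refl
  dTime-cong {false} a refl c'≡c rewrite c'≡c refl = refl

  Holds : Scenario (VarΦ n) → Constraint (TaskΦ n) (VarΦ n) → Set
  Holds s c = σ s (Constraint.Y c) ℚ.- σ s (Constraint.X c) ℚ.≤ Constraint.δ c

  cvar-≡ : ∀ s i b → s ⊨ ((vc0 i , b) ∷ (vc1 i , b) ∷ []) → ∀ r → s (cvar r i) ≡ b
  cvar-≡ s i b holds with ⊨⇒All s ((vc0 i , b) ∷ (vc1 i , b) ∷ []) holds
  ... | e₀ ∷ e₁ ∷ [] = λ { false → e₀ ; true → e₁ }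

  B-≤-C+K : ∀ s i b → xs s i ≡ b →
          ⟦ τ s (tB (suc i)) ⟧ ℚ.- ⟦ τ s (OΦ (cvar b i)) ⟧ ℚ.≤ ℤtoℚ (+ (n + 4))
  B-≤-C+K s i b x≡b = sub-≤-pos _ (τ s (OΦ (cvar b i))) K B-≤-C+K+K
    where
    deviated-suc : deviated s (suc i) ≡ postponed s i b
    deviated-suc = trans (deviatesBefore-suc g (xs s) (ys s) i)
                         (cong (λ x → deviated s (inject₁ i) ∨ (x xor recommended s i)) x≡b)
    open ℕP.≤-Reasoning hiding (start)
    B-≤-C+K+K : τ s (tB (suc i)) ℕ.≤ τ s (OΦ (cvar b i)) + K
    B-≤-C+K+K = begin
        bTime (deviated s (suc i)) (start (suc i))        ≡⟨ cong₂ bTime deviated-suc (start-suc i) ⟩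
        bTime (postponed s i b) (start (inject₁ i) + K)   ≤⟨ bTime-≤-cTime (postponed s i b) _ ⟩
        cTime (postponed s i b) (start (inject₁ i)) + K   ≡⟨ cong (_+ K) (sym (τ-cvar s b i)) ⟩
        τ s (OΦ (cvar b i)) + K                           ∎

  stage-viable : ∀ s i c → c ∈ perStage n i → s ⊨ Constraint.label c → Holds s c
  stage-viable s i _ (here refl) holds =
    sub-≤-pos _ (τ s (tB (inject₁ i))) 1
      (dTime-≤-bTime (deviated s (inject₁ i)) (start (inject₁ i)) (cvar-≡ s i true holds (recommended s i)))
  stage-viable s i _ (there (here refl)) holds =
    sub-≤-neg (start (inject₁ i)) _ (n + 2)
      (dTime-≥ (deviated s (inject₁ i)) (start (inject₁ i)) (cvar-≡ s i false holds (recommended s i)))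
  stage-viable s i _ (there (there (here refl))) _ =
    sub-≤-neg (start (inject₁ i)) _ (n + 2) ℕP.≤-refl
  stage-viable s i _ (there (there (there (here refl)))) _ =
    sub-≤-neg (τ s (tX i)) _ 1 (ℕP.≤-reflexive (next-offset n (start (inject₁ i))))
    where
    next-offset : ∀ n a → a + (n + 2) + 1 ≡ a + (n + 3)
    next-offset = ℕSolver.solve-∀
  stage-viable s i _ (there (there (there (there (here refl))))) _ =
    sub-≤-neg (τ s (tY i)) _ 1
      (ℕP.≤-reflexive (trans (next-stage n (start (inject₁ i))) (sym (start-suc i))))
    where
    next-stage : ∀ n a → a + (n + 3) + 1 ≡ a + (n + 4)
    next-stage = ℕSolver.solve-∀
  stage-viable s i _ (there (there (there (there (there (here refl)))))) holds =
    B-≤-C+K s i false (literal-holds s (vx i) false (BoolP.∧-conicalˡ (not (s (vx i))) true holds))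
  stage-viable s i _ (there (there (there (there (there (there (here refl))))))) holds =
    B-≤-C+K s i true (literal-holds s (vx i) true (BoolP.∧-conicalˡ (s (vx i)) true holds))

  qvarVal-play : ∀ s p → qvarVal (play s) p ≡ s (qvarToVar p)
  qvarVal-play s (qx i) = cong proj₁ (lookup∘tabulate (λ i → xs s i , ys s i) i)
  qvarVal-play s (qy i) = cong proj₂ (lookup∘tabulate (λ i → xs s i , ys s i) i)

  qlitVal-play : ∀ s (l : QLit n) → s (qvarToVar (proj₁ l)) ≡ not (proj₂ l) →
                 qlitVal (play s) l ≡ false
  qlitVal-play s (p , true)  e rewrite qvarVal-play s p | e = refl
  qlitVal-play s (p , false) e rewrite qvarVal-play s p | e = refl

  clauseLabel-falsifies : ∀ s j → s ⊨ clauseLabel (φ j) → ∀ k → qlitVal (play s) (φ j k) ≡ false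
  clauseLabel-falsifies s j holds k =
    qlitVal-play s (φ j k) (literal k (⊨⇒All s (clauseLabel (φ j)) holds))
    where
    literal : ∀ k → All (λ l → s (proj₁ l) ≡ proj₂ l) (clauseLabel (φ j)) →
              s (qvarToVar (proj₁ (φ j k))) ≡ not (proj₂ (φ j k))
    literal zero             (h ∷ _)         = h
    literal (suc zero)       (_ ∷ h ∷ _)     = h
    literal (suc (suc zero)) (_ ∷ _ ∷ h ∷ _) = h

  falsified-clause-deviates : ∀ s j → s ⊨ clauseLabel (φ j) → deviated s (fromℕ n) ≡ true
  falsified-clause-deviates s j holds with deviated s (fromℕ n) in conforming
  ... | true  = refl
  ... | false with conforming-play-wins g (xs s) (ys s) conforming j
  ...   | k , sat with trans (sym sat) (clauseLabel-falsifies s j holds k)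
  ...     | ()

  viable : Viable Γ σ
  viable s _ (here refl) _ = sub-≤-pos 0 0 0 z≤n
  viable s c (there c∈) holds with ∈-++⁻ (concatMap (perStage n) (allFinL n)) c∈
  ... | inj₁ c∈stages =
    let i , c∈stage = satisfied (∈-concatMap⁻ (perStage n) {xs = allFinL n} c∈stages)
    in stage-viable s i c c∈stage holds
  ... | inj₂ c∈clauses with ∈-map⁻ _ c∈clauses
  ...   | j , _ , refl = sub-≤-neg (start (fromℕ n)) _ (n + 1)
          (subst (λ d → start (fromℕ n) + (n + 1) ℕ.≤ bTime d (start (fromℕ n)))
                 (sym (falsified-clause-deviates s j holds)) ℕP.≤-refl)

  module History (s s' : Scenario (VarΦ n)) (t : ℕ) (same-history : HistEq Γ σ ⟦ t ⟧ s s') where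

    observed-agrees : ∀ p → τ s (OΦ p) ℕ.< t → s p ≡ s' p
    observed-agrees p lt = proj₂ (same-history p) (refl , ⟦⟧-mono-< lt)

    prefix-agrees : ∀ q → q * K ℕ.≤ t → AgreeBelow q (xs s) (xs s') × AgreeBelow q (ys s) (ys s')
    prefix-agrees q qK≤t = (λ j j<q → observed-agrees (vx j) (x-before j j<q))
                         , (λ j j<q → observed-agrees (vy j) (y-before j j<q))
      where
      y-before : ∀ j → toℕ j ℕ.< q → τ s (tY j) ℕ.< t
      y-before j j<q rewrite toℕ-inject₁ j = ℕP.<-≤-trans (stage-precedes j<q) qK≤t
      x-before : ∀ j → toℕ j ℕ.< q → τ s (tX j) ℕ.< t
      x-before j j<q = ℕP.<-trans (ℕP.+-monoʳ-< (start (inject₁ j)) (ℕP.+-monoʳ-< n (ℕP.n<1+n 2)))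
                                  (y-before j j<q)

    deviated-agrees : ∀ k → start k ℕ.≤ t → deviated s k ≡ deviated s' k
    deviated-agrees k le = let (xs≈ , ys≈) = prefix-agrees (toℕ k) le
                           in deviatesBefore-cong g k xs≈ ys≈

    recommended-agrees : ∀ i → start (inject₁ i) ℕ.≤ t → recommended s i ≡ recommended s' i
    recommended-agrees i le =
      move-cong g i (proj₂ (prefix-agrees (toℕ i) (subst (λ q → q * K ℕ.≤ t) (toℕ-inject₁ i) le)))

    postponed-agrees : ∀ i b → start (inject₁ i) ℕ.≤ t → postponed s i b ≡ postponed s' i b
    postponed-agrees i b le =
      cong₂ (λ d r → d ∨ (b xor r)) (deviated-agrees (inject₁ i) le) (recommended-agrees i le)

  recommended-cvar-at-start : ∀ s i → deviated s (inject₁ i) ≡ false →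
                              τ s (OΦ (cvar (recommended s i) i)) ≡ start (inject₁ i)
  recommended-cvar-at-start s i conforming =
    trans (τ-cvar s r i)
          (cong (λ p → cTime p (start (inject₁ i))) (cong₂ _∨_ conforming (BoolP.xor-same r)))
    where
    r : Bool
    r = recommended s i

  τ-history-determined : ∀ s s' X → HistEq Γ σ (σ s X) s s' → τ s' X ≡ τ s X
  τ-history-determined s s' (tA k)  h = refl
  τ-history-determined s s' (tX i)  h = refl
  τ-history-determined s s' (tY i)  h = refl
  τ-history-determined s s' (tB k)  h =
    cong (λ d → bTime d (start k)) (sym (deviated-agrees k (start-≤-bTime (deviated s k) (start k))))
    where open History s s' (τ s (tB k)) h
  τ-history-determined s s' (tC0 i) h =
    cong (λ p → cTime p (start (inject₁ i))) (sym (postponed-agrees i false (start-≤-cTime _ _)))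
    where open History s s' (τ s (tC0 i)) h
  τ-history-determined s s' (tC1 i) h =
    cong (λ p → cTime p (start (inject₁ i))) (sym (postponed-agrees i true (start-≤-cTime _ _)))
    where open History s s' (τ s (tC1 i)) h
  τ-history-determined s s' (tD i)  h =
    dTime-cong a (sym (deviated-agrees (inject₁ i) (ℕP.<⇒≤ a<D))) observed-cvar-agrees
    where
    open History s s' (τ s (tD i)) h
    a : ℕ
    a = start (inject₁ i)
    r : Bool
    r = recommended s i
    a<D : a ℕ.< τ s (tD i)
    a<D = start-<-dTime (deviated s (inject₁ i)) (s (cvar r i)) a
    observed-cvar-agrees : deviated s (inject₁ i) ≡ false →
                           s' (cvar (recommended s' i) i) ≡ s (cvar r i)
    observed-cvar-agrees conforming =
      trans (cong (λ b → s' (cvar b i)) (sym (recommended-agrees i (ℕP.<⇒≤ a<D))))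
            (sym (observed-agrees (cvar r i)
                   (subst (ℕ._< τ s (tD i)) (sym (recommended-cvar-at-start s i conforming)) a<D)))

  dynamic : Dynamic Γ σ
  dynamic s s' X _ h = refl , cong ⟦_⟧ (τ-history-determined s s' X h)

lemma17 : (n m : ℕ) (φ : Formula n m) → Q3SATTrue φ →
          DynamicallyControllable (ΓΦ n m φ)
lemma17 n m φ g = σ , viable , dynamic
  where open Strategy n m φ g
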